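{- For every positive integer $n$ we have $F(n)\le n^2$. Moreover, whenever $n$ is a perfect square, $F(n)\ge n^{3/2}$.
   Context: $[n]=\{1,\dots,n\}$. For integer triples $a,b$, write $a<_2b$ if $a_i<b_i$ for at least two indices $i\in\{1,2,3\}$. A sequence $a^1,\dots,a^m$ of triples is 2-increasing if $a^i<_2a^j$ whenever $i<j$. $F(n)$ denotes the maximal length of a 2-increasing sequence of triples with every coordinate in $[n]$. -}

module Defs where

open import Data.Nat using (ℕ; _<_; _≤_; _*_; _^_)
open import Data.Fin using (Fin) renaming (_<_ to _<ᶠ_)
open import Data.Product using (_×_; _,_)
open import Data.Sum using (_⊎_)

-- integer triples (coordinates in ℕ; only triples with coordinates in [n] are used)
Triple : Set
Triple = ℕ × ℕ × ℕ

_<₂_ : Triple → Triple → Set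
(a₁ , a₂ , a₃) <₂ (b₁ , b₂ , b₃) =
  (a₁ < b₁ × a₂ < b₂) ⊎ (a₁ < b₁ × a₃ < b₃) ⊎ (a₂ < b₂ × a₃ < b₃)

InCube : ℕ → Triple → Set
InCube n (a₁ , a₂ , a₃) = (1 ≤ a₁ × a₁ ≤ n) × (1 ≤ a₂ × a₂ ≤ n) × (1 ≤ a₃ × a₃ ≤ n)

Is2IncreasingIn : ℕ → (m : ℕ) → (Fin m → Triple) → Set
Is2IncreasingIn n m a =
  (∀ i → InCube n (a i)) × (∀ i j → i <ᶠ j → a i <₂ a j)

-- Upper bound: two triples agreeing in their first two coordinates are <₂-incomparable,
-- so along a 2-increasing sequence the map a ↦ (a₁ , a₂) ∈ [n]² is injective.
-- Lower bound for n = k²: write t < k³ in base k as d₂d₁d₀ and send it to the triple of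
-- two-digit numbers (d₂d₁ , d₂d₀ , d₁d₀). If t < t' then either d₂ < d₂' (first two
-- coordinates grow), or d₂ = d₂' and d₁ < d₁' (first and third grow), or d₂d₁ = d₂'d₁'
-- and d₀ < d₀' (last two grow).
module Submission where

open import Defs
open import Data.Nat using (ℕ; suc; _≤_; _<_; _*_; _^_; _+_; _/_; _%_; NonZero; z≤n; s≤s)
open import Data.Nat.Properties
open import Data.Nat.DivMod
open import Data.Fin using (Fin; toℕ; fromℕ<; combine) renaming (_<_ to _<ᶠ_)
import Data.Fin.Properties as Fin
open import Data.Product using (_×_; Σ; _,_)
open import Data.Sum using (_⊎_; inj₁; inj₂)
open import Relation.Nullary using (¬_; contradiction)
open import Relation.Binary.PropositionalEquality
open import Relation.Binary.Definitions using (tri<; tri≈; tri>)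
open import Function.Definitions using (Injective)

<₂-irrefl-on-first-two : ∀ {x y z z'} → ¬ (x , y , z) <₂ (x , y , z')
<₂-irrefl-on-first-two (inj₁ (x<x , _))        = <-irrefl refl x<x
<₂-irrefl-on-first-two (inj₂ (inj₁ (x<x , _))) = <-irrefl refl x<x
<₂-irrefl-on-first-two (inj₂ (inj₂ (y<y , _))) = <-irrefl refl y<y

<-separated⇒injective : ∀ {m} {B : Set} (f : Fin m → B) →
                        (∀ {i j} → i <ᶠ j → f i ≢ f j) → Injective _≡_ _≡_ f
<-separated⇒injective f separated {i} {j} fi≡fj with Fin.<-cmp i j
... | tri< i<j _ _ = contradiction fi≡fj (separated i<j)
... | tri≈ _ i≡j _ = i≡j
... | tri> _ _ j<i = contradiction (sym fi≡fj) (separated j<i)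

-- x ∈ [n] sits at index x - 1 of Fin n.
position : ∀ {n x} → 1 ≤ x × x ≤ n → Fin n
position {x = suc x} (_ , x<n) = fromℕ< x<n

position-injective : ∀ {n x y} (p : 1 ≤ x × x ≤ n) (q : 1 ≤ y × y ≤ n) →
                     position p ≡ position q → x ≡ y
position-injective {x = suc x} {y = suc y} (_ , x<n) (_ , y<n) eq =
  cong suc (Fin.fromℕ<-injective x y x<n y<n eq)

cellOfFirstTwo : ∀ {n} u → InCube n u → Fin (n * n)
cellOfFirstTwo (x , y , z) (x∈ , y∈ , _) = combine (position x∈) (position y∈)

cellOfFirstTwo-≡⇒¬<₂ : ∀ {n} u v (p : InCube n u) (q : InCube n v) →
                        cellOfFirstTwo u p ≡ cellOfFirstTwo v q → ¬ u <₂ v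
cellOfFirstTwo-≡⇒¬<₂ (x , y , z) (x' , y' , z') (x∈ , y∈ , _) (x'∈ , y'∈ , _) eq
  with Fin.combine-injective (position x∈) (position y∈) (position x'∈) (position y'∈) eq
... | eqˣ , eqʸ with refl ← position-injective x∈ x'∈ eqˣ | refl ← position-injective y∈ y'∈ eqʸ
  = <₂-irrefl-on-first-two

2-increasing-length≤n² : ∀ n m (a : Fin m → Triple) → Is2IncreasingIn n m a → m ≤ n ^ 2
2-increasing-length≤n² n m a (inCube , increasing) =
  subst (m ≤_) (cong (n *_) (sym (*-identityʳ n))) (Fin.injective⇒≤ cell-injective)
  where
  cell : Fin m → Fin (n * n)
  cell i = cellOfFirstTwo (a i) (inCube i)

  cell-injective : Injective _≡_ _≡_ cell
  cell-injective = <-separated⇒injective cell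
    λ {i} {j} i<j eq → cellOfFirstTwo-≡⇒¬<₂ (a i) (a j) (inCube i) (inCube j) eq (increasing i j i<j)

/-%-lex : ∀ d .{{_ : NonZero d}} {t t'} → t < t' →
          t / d < t' / d ⊎ (t / d ≡ t' / d × t % d < t' % d)
/-%-lex d {t} {t'} t<t' with m≤n⇒m<n∨m≡n (/-monoˡ-≤ d (<⇒≤ t<t'))
... | inj₁ q<q' = inj₁ q<q'
... | inj₂ q≡q' = inj₂ (q≡q' , +-cancelʳ-< (t' / d * d) (t % d) (t' % d)
        (subst₂ _<_ (trans (m≡m%n+[m/n]*n t d) (cong (λ q → t % d + q * d) q≡q'))
                    (m≡m%n+[m/n]*n t' d) t<t'))

/-reflects-< : ∀ d .{{_ : NonZero d}} {m n} → m / d < n / d → m < n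
/-reflects-< d m/d<n/d = ≰⇒> λ n≤m → <⇒≱ m/d<n/d (/-monoˡ-≤ d n≤m)

q*d+r<q'*d : ∀ {d q q' r} → q < q' → r < d → q * d + r < q' * d
q*d+r<q'*d {d} {q} {q'} {r} q<q' r<d = begin-strict
  q * d + r  <⟨ +-monoʳ-< (q * d) r<d ⟩
  q * d + d  ≡⟨ +-comm (q * d) d ⟩
  suc q * d  ≤⟨ *-monoˡ-≤ d q<q' ⟩
  q' * d     ∎
  where open ≤-Reasoning

module DigitPairs (k : ℕ) .{{_ : NonZero k}} where

  K : ℕ
  K = k * k

  instance
    K-nonZero : NonZero K
    K-nonZero = m*n≢0 k k

  -- With t = d₂ k² + d₁ k + d₀: high = d₂d₁, outer = d₂d₀, low = d₁d₀.
  high outer low : ℕ → ℕ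
  high  t = t / k
  outer t = t / K * k + t % k
  low   t = t % K

  digitPairs : ℕ → Triple
  digitPairs t = suc (high t) , suc (outer t) , suc (low t)

  digitPairs-<₂ : ∀ {t t'} → t < t' → digitPairs t <₂ digitPairs t'
  digitPairs-<₂ {t} {t'} t<t' with /-%-lex K t<t'
  ... | inj₁ d₂<d₂' = inj₁ (s≤s high<high' , s≤s outer<outer')
    where
    high<high' : high t < high t'
    high<high' = /-reflects-< k (subst₂ _<_ (sym (m/n/o≡m/[n*o] t k k))
                                            (sym (m/n/o≡m/[n*o] t' k k)) d₂<d₂')
    outer<outer' : outer t < outer t'
    outer<outer' = <-≤-trans (q*d+r<q'*d d₂<d₂' (m%n<n t k)) (m≤m+n (t' / K * k) (t' % k))
  ... | inj₂ (d₂≡d₂' , low<low') with /-%-lex k t<t'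
  ...   | inj₁ high<high' = inj₂ (inj₁ (s≤s high<high' , s≤s low<low'))
  ...   | inj₂ (_ , d₀<d₀') = inj₂ (inj₂ (s≤s outer<outer' , s≤s low<low'))
    where
    outer<outer' : outer t < outer t'
    outer<outer' = +-mono-≤-< (≤-reflexive (cong (_* k) d₂≡d₂')) d₀<d₀'

  k³≡K*k : k ^ 3 ≡ K * k
  k³≡K*k = begin
    k * (k * (k * 1)) ≡⟨ cong (λ x → k * (k * x)) (*-identityʳ k) ⟩
    k * (k * k)       ≡⟨ *-assoc k k k ⟨
    K * k             ∎
    where open ≡-Reasoning

  digitPairs-inCube : ∀ t → t < k ^ 3 → InCube K (digitPairs t)
  digitPairs-inCube t t<k³ =
    (s≤s z≤n , m<n*o⇒m/o<n t<K*k) ,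
    (s≤s z≤n , q*d+r<q'*d {k} {q' = k} (m<n*o⇒m/o<n {o = K} t<k*K) (m%n<n t k)) ,
    (s≤s z≤n , m%n<n t K)
    where
    t<K*k : t < K * k
    t<K*k = subst (t <_) k³≡K*k t<k³
    t<k*K : t < k * K
    t<k*K = subst (t <_) (*-comm K k) t<K*k

  sequence : Fin (k ^ 3) → Triple
  sequence i = digitPairs (toℕ i)

  sequence-2-increasing : Is2IncreasingIn K (k ^ 3) sequence
  sequence-2-increasing =
    (λ i → digitPairs-inCube (toℕ i) (Fin.toℕ<n i)) , (λ i j i<j → digitPairs-<₂ i<j)

proposition1p4 : ((n : ℕ) → 1 ≤ n → (m : ℕ) → (a : Fin m → Triple) → Is2IncreasingIn n m a → m ≤ n ^ 2)
    × ((k : ℕ) → 1 ≤ k → Σ ℕ (λ m → Σ (Fin m → Triple) (λ a → Is2IncreasingIn (k * k) m a × k ^ 3 ≤ m)))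
proposition1p4 = (λ n _ → 2-increasing-length≤n² n) , lowerBound
  where
  lowerBound : (k : ℕ) → 1 ≤ k → Σ ℕ (λ m → Σ (Fin m → Triple) (λ a → Is2IncreasingIn (k * k) m a × k ^ 3 ≤ m))
  lowerBound k@(suc _) _ = k ^ 3 , DigitPairs.sequence k , DigitPairs.sequence-2-increasing k , ≤-refl
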